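{- Let $n\ge1$ and $\pi,\pi'\in\mathfrak{B}_n$. If $\mathrm{Pe}_B(\pi)=\mathrm{Pe}_B(\pi')$ and $\pi(1)$, $\pi'(1)$ have the same sign, then $\mathcal{D}_B(\pi)=\mathcal{D}_B(\pi')$.
   Context: $\mathfrak{B}_n$: signed permutations, bijections $\pi$ of $\{ -n,\dots,n\}$ with $\pi(-i)=-\pi(i)$, $\pi(0)=0$. $\mathrm{Des}_B(\pi)=\{i\in\{0,\dots,n-1\}:\pi(i)>\pi(i+1)\}$; $\mathrm{Pe}_B(\pi)=\{i\in\{1,\dots,n-1\}:\pi(i-1)<\pi(i)>\pi(i+1)\}$. Let $T_\infty=\{0,1^{ -1},1,2^{ -1},2,\dots\}$ be totally ordered as listed, with $\varepsilon(0)=\varepsilon(j)=1$, $\varepsilon(j^{ -1})=-1$, $|0|=0$, $|j|=|j^{ -1}|=j$. Write $a\le^+b$ if $a<b$ or ($a=b$, $\varepsilon(a)=1$), $a\le^-b$ if $a<b$ or ($a=b$, $\varepsilon(a)=-1$). With commuting indeterminates $z_0,z_1,\dots$, $\mathcal{D}_B(\pi)=\sum\prod_{s=1}^n z_{|a_s|}$ over all $(a_1,\dots,a_n)\in T_\infty^n$ such that, with $a_0=0$, for each $s\in\{0,\dots,n-1\}$, $a_s\le^+a_{s+1}$ if $s\notin\mathrm{Des}_B(\pi)$ and $a_s\le^-a_{s+1}$ if $s\in\mathrm{Des}_B(\pi)$. -}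

module Defs where

open import Data.Nat as ℕ using (ℕ; zero; suc; _<?_)
open import Data.Integer as ℤ using (ℤ; +_; -_; 0ℤ)
open import Data.Fin using (Fin; zero; suc; toℕ; fromℕ<; inject₁)
open import Data.Fin.Permutation using (Permutation′; _⟨$⟩ʳ_)
open import Data.Fin.Properties using (all?)
open import Data.Bool using (Bool; true; false)
open import Data.Sign as Sign using (Sign)
open import Data.List using (List; []; _∷_; _++_; length; filter; concatMap; map; upTo)
open import Data.Vec as Vec using (Vec; []; _∷_; lookup)
open import Data.Product using (_×_; _,_)
open import Data.Sum using (_⊎_; inj₁; inj₂)
open import Relation.Nullary using (¬_; Dec; yes; no)
open import Relation.Nullary.Decidable using (_×-dec_; _⊎-dec_; _→-dec_; ¬?)
open import Relation.Binary.PropositionalEquality using (_≡_; refl)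

-- Signed permutations of {-n,…,n}.
-- π is determined by its values π(1),…,π(n): π(i) = ±(σ(i)+1), where
-- σ is a permutation of Fin n (i.e. of {1,…,n} shifted by one) and the
-- sign of π(i) is + iff positive i = true.  Then π(0)=0, π(-i) = -π(i).

record SignedPerm (n : ℕ) : Set where
  field
    perm     : Permutation′ n
    positive : Fin n → Bool
open SignedPerm public

applySign : Bool → ℕ → ℤ
applySign true  k = + k
applySign false k = - (+ k)

-- value π(i) for i ∈ {0,…,n}; (set to 0 for i > n, never used there)
val : ∀ {n} → SignedPerm n → ℕ → ℤ
val π zero = 0ℤ
val {n} π (suc i) with i <? n
... | yes p = applySign (positive π (fromℕ< p)) (suc (toℕ (perm π ⟨$⟩ʳ fromℕ< p)))
... | no _  = 0ℤ

DesB : ∀ {n} → SignedPerm n → ℕ → Set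
DesB {n} π i = (i ℕ.< n) × (val π (suc i) ℤ.< val π i)

PeB : ∀ {n} → SignedPerm n → ℕ → Set
PeB {n} π i = (1 ℕ.≤ i) × (i ℕ.< n)
            × (val π (i ℕ.∸ 1) ℤ.< val π i) × (val π (suc i) ℤ.< val π i)

-- The totally ordered alphabet T∞ = {0 < 1⁻¹ < 1 < 2⁻¹ < 2 < …}.
-- inv k stands for (k+1)⁻¹ and pos k for k+1.

data T∞ : Set where
  t0  : T∞
  inv : ℕ → T∞
  pos : ℕ → T∞

rank : T∞ → ℕ
rank t0      = 0
rank (inv k) = suc (2 ℕ.* k)
rank (pos k) = 2 ℕ.+ 2 ℕ.* k

_<T_ : T∞ → T∞ → Set
a <T b = rank a ℕ.< rank b

ε : T∞ → Sign
ε t0      = Sign.+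
ε (inv _) = Sign.-
ε (pos _) = Sign.+

∣_∣T : T∞ → ℕ
∣ t0 ∣T    = 0
∣ inv k ∣T = suc k
∣ pos k ∣T = suc k

-- a ≤⁺ b  iff  a < b or (a = b and ε(a) = 1);  a ≤⁻ b similarly with ε(a) = -1.
-- (rank is injective, so "a = b" is "rank a = rank b".)
_≤⁺_ : T∞ → T∞ → Set
a ≤⁺ b = (a <T b) ⊎ ((rank a ≡ rank b) × (ε a ≡ Sign.+))

_≤⁻_ : T∞ → T∞ → Set
a ≤⁻ b = (a <T b) ⊎ ((rank a ≡ rank b) × (ε a ≡ Sign.-))

Admissible : ∀ {n} → SignedPerm n → Vec T∞ n → Set
Admissible {n} π a = (s : Fin n) →
  (¬ DesB π (toℕ s) → lookup (t0 ∷ a) (inject₁ s) ≤⁺ lookup (t0 ∷ a) (suc s)) ×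
  (DesB π (toℕ s) → lookup (t0 ∷ a) (inject₁ s) ≤⁻ lookup (t0 ∷ a) (suc s))

mult : ∀ {n} → Vec T∞ n → ℕ → ℕ
mult []      k = 0
mult (x ∷ a) k with ∣ x ∣T ℕ.≟ k
... | yes _ = suc (mult a k)
... | no  _ = mult a k

HasMonomial : ∀ {n} (M : ℕ) → Vec ℕ (suc M) → Vec T∞ n → Set
HasMonomial M e a = (k : Fin (suc M)) → mult a (toℕ k) ≡ lookup e k

_≟S_ : (x y : Sign) → Dec (x ≡ y)
Sign.+ ≟S Sign.+ = yes refl
Sign.+ ≟S Sign.- = no (λ ())
Sign.- ≟S Sign.+ = no (λ ())
Sign.- ≟S Sign.- = yes refl

_≤⁺?_ : (a b : T∞) → Dec (a ≤⁺ b)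
a ≤⁺? b = (rank a ℕ.<? rank b) ⊎-dec ((rank a ℕ.≟ rank b) ×-dec (ε a ≟S Sign.+))

_≤⁻?_ : (a b : T∞) → Dec (a ≤⁻ b)
a ≤⁻? b = (rank a ℕ.<? rank b) ⊎-dec ((rank a ℕ.≟ rank b) ×-dec (ε a ≟S Sign.-))

DesB? : ∀ {n} (π : SignedPerm n) (i : ℕ) → Dec (DesB π i)
DesB? {n} π i = (i ℕ.<? n) ×-dec (val π (suc i) ℤ.<? val π i)

Admissible? : ∀ {n} (π : SignedPerm n) (a : Vec T∞ n) → Dec (Admissible π a)
Admissible? π a = all? λ s →
  (¬? (DesB? π (toℕ s)) →-dec (lookup (t0 ∷ a) (inject₁ s) ≤⁺? lookup (t0 ∷ a) (suc s))) ×-dec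
  (DesB? π (toℕ s) →-dec (lookup (t0 ∷ a) (inject₁ s) ≤⁻? lookup (t0 ∷ a) (suc s)))

HasMonomial? : ∀ {n} (M : ℕ) (e : Vec ℕ (suc M)) (a : Vec T∞ n) → Dec (HasMonomial M e a)
HasMonomial? M e a = all? λ k → mult a (toℕ k) ℕ.≟ lookup e k

lettersUpTo : ℕ → List T∞
lettersUpTo M = t0 ∷ concatMap (λ k → inv k ∷ pos k ∷ []) (upTo M)

words : (n : ℕ) → List T∞ → List (Vec T∞ n)
words zero    L = [] ∷ []
words (suc n) L = concatMap (λ x → map (x ∷_) (words n L)) L

-- Coefficient of the monomial z₀^{e₀} z₁^{e₁} ⋯ z_M^{e_M} in D_B(π).
-- (Every word carrying this monomial has all letters of absolute value ≤ M,
-- so it is enumerated by words n (lettersUpTo M), each exactly once.)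
coeffDB : ∀ {n} → SignedPerm n → (M : ℕ) → Vec ℕ (suc M) → ℕ
coeffDB {n} π M e =
  length (filter (Admissible? π) (filter (HasMonomial? M e) (words n (lettersUpTo M))))

_≡DB_ : ∀ {n} → SignedPerm n → SignedPerm n → Set
π ≡DB π' = ∀ (M : ℕ) (e : Vec ℕ (suc M)) → coeffDB π M e ≡ coeffDB π' M e

-- A coefficient of D_B(π) counts the words of that weight that are admissible for the sign sequence
-- of the steps π(i) → π(i+1) (- at descents, + elsewhere). Turning into a descent an ascent that
-- follows a descent and is not followed by a descent leaves this count unchanged: toggling j⁻¹ ↔ j
-- on both letters of an equal pair a_i = a_{i+1} at that step is a weight-preserving involution of
-- words that exchanges the two admissibility conditions. Such moves keep the first sign (that of
-- π(1)) and the peak set, and they connect any two sign sequences that share both.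

module Submission where

open import Defs
open import Data.Nat as ℕ using (ℕ; zero; suc; _+_; _<_; _<ᵇ_; z<s; s≤s; z≤n; _<?_)
import Data.Nat.Properties as ℕP
open import Data.Integer as ℤ using (-[1+_]; 0ℤ; sign)
import Data.Integer.Properties as ℤP
open import Data.Sign as Sign using (Sign)
open import Data.Bool using (Bool; true; false; _∧_; if_then_else_; T)
open import Data.Bool.Properties using (∧-zeroʳ; T-∧)
open import Data.Fin using (Fin; toℕ; fromℕ<; inject₁; zero; suc)
open import Data.Fin.Properties using (toℕ-injective; fromℕ<-injective)
open import Data.Fin.Permutation using (_⟨$⟩ʳ_; _⟨$⟩ˡ_; inverseˡ)
open import Data.List using (List; []; _∷_; _++_; length; filter; map; concatMap; upTo)
open import Data.List.Properties using (length-++; filter-++)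
open import Data.Vec using (Vec; []; _∷_; head; lookup; tabulate)
open import Data.Product using (_×_; _,_; proj₁; proj₂)
open import Data.Sum using (_⊎_; inj₁; inj₂)
open import Function using (_∘_; const; _⇔_; mk⇔; Equivalence)
open import Function.Definitions using (Injective)
import Function.Properties.Equivalence as ⇔
open import Relation.Nullary using (¬_; Dec; yes; no; does; contradiction)
open import Relation.Nullary.Decidable using (does-⇔; dec-false; map′; _×-dec_; _⊎-dec_; T?)
open import Relation.Unary using (Pred; Decidable)
open import Relation.Unary.Properties using (_∩?_)
open import Relation.Binary.Definitions using (DecidableEquality; tri<; tri≈; tri>)
open import Relation.Binary.PropositionalEquality
open import Relation.Binary.Construct.Closure.Equivalence as EqClosure using (EqClosure)
open import Relation.Binary.Construct.Closure.ReflexiveTransitive using (_◅◅_)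
open import Algebra.Properties.CommutativeSemigroup ℕP.+-commutativeSemigroup
  using (interchange; x∙yz≈y∙xz)

open Equivalence using (to; from)

∑ : {A : Set} → List A → (A → ℕ) → ℕ
∑ []       f = 0
∑ (x ∷ xs) f = f x + ∑ xs f

∑-cong : {A : Set} (xs : List A) {f g : A → ℕ} → (∀ x → f x ≡ g x) → ∑ xs f ≡ ∑ xs g
∑-cong []       f≗g = refl
∑-cong (x ∷ xs) f≗g = cong₂ _+_ (f≗g x) (∑-cong xs f≗g)

∑-+ : {A : Set} (xs : List A) (f g : A → ℕ) → ∑ xs (λ x → f x + g x) ≡ ∑ xs f + ∑ xs g
∑-+ []       f g = refl
∑-+ (x ∷ xs) f g =
  trans (cong ((f x + g x) +_) (∑-+ xs f g)) (interchange (f x) (g x) (∑ xs f) (∑ xs g))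

∑∑ : {A : Set} → List A → (A → A → ℕ) → ℕ
∑∑ xs F = ∑ xs (λ x → ∑ xs (F x))

∑∑-cong : {A : Set} (xs : List A) {F G : A → A → ℕ} → (∀ x y → F x y ≡ G x y) →
  ∑∑ xs F ≡ ∑∑ xs G
∑∑-cong xs F≗G = ∑-cong xs (λ x → ∑-cong xs (F≗G x))

∑∑-+ : {A : Set} (xs : List A) (F G : A → A → ℕ) →
  ∑∑ xs (λ x y → F x y + G x y) ≡ ∑∑ xs F + ∑∑ xs G
∑∑-+ xs F G =
  trans (∑-cong xs (λ x → ∑-+ xs (F x) (G x))) (∑-+ xs (λ x → ∑ xs (F x)) (λ x → ∑ xs (G x)))

-- Split into the diagonal part, reindexed by τ in both variables, and the untouched off-diagonal part.
∑∑-reindex-diagonal : {A : Set} (_≟_ : DecidableEquality A) {τ : A → A} → Injective _≡_ _≡_ τ →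
  (xs : List A) → (∀ h → ∑ xs (h ∘ τ) ≡ ∑ xs h) → (F : A → A → ℕ) →
  ∑∑ xs (λ x y → if does (x ≟ y) then F (τ x) (τ y) else F x y) ≡ ∑∑ xs F
∑∑-reindex-diagonal {A} _≟_ {τ} τ-injective xs ∑-τ F = begin
  ∑∑ xs (λ x y → if does (x ≟ y) then F (τ x) (τ y) else F x y) ≡⟨ ∑∑-cong xs split ⟩
  ∑∑ xs (λ x y → diag (τ x) (τ y) + off x y)                     ≡⟨ ∑∑-+ xs _ off ⟩
  ∑∑ xs (λ x y → diag (τ x) (τ y)) + ∑∑ xs off                   ≡⟨ cong (_+ ∑∑ xs off) reindex ⟩
  ∑∑ xs diag + ∑∑ xs off                                          ≡⟨ sym (∑∑-+ xs diag off) ⟩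
  ∑∑ xs (λ x y → diag x y + off x y)                              ≡⟨ ∑∑-cong xs merge ⟩
  ∑∑ xs F                                                         ∎
  where
  open ≡-Reasoning
  diag off : A → A → ℕ
  diag x y = if does (x ≟ y) then F x y else 0
  off  x y = if does (x ≟ y) then 0 else F x y

  split : ∀ x y → (if does (x ≟ y) then F (τ x) (τ y) else F x y) ≡ diag (τ x) (τ y) + off x y
  split x y with x ≟ y | τ x ≟ τ y
  ... | yes _   | yes _     = sym (ℕP.+-identityʳ _)
  ... | no _    | no _      = refl
  ... | yes x≡y | no τx≢τy  = contradiction (cong τ x≡y) τx≢τy
  ... | no x≢y  | yes τx≡τy = contradiction (τ-injective τx≡τy) x≢y

  merge : ∀ x y → diag x y + off x y ≡ F x y
  merge x y with x ≟ y
  ... | yes _ = ℕP.+-identityʳ _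
  ... | no _  = refl

  reindex : ∑∑ xs (λ x y → diag (τ x) (τ y)) ≡ ∑∑ xs diag
  reindex = trans (∑-cong xs (λ x → ∑-τ (diag (τ x)))) (∑-τ (λ x → ∑ xs (diag x)))

#words : {A : Set} → List A → (n : ℕ) → (Vec A n → Bool) → ℕ
#words L zero    P = if P [] then 1 else 0
#words L (suc n) P = ∑ L (λ x → #words L n (P ∘ (x ∷_)))

#words-cong : {A : Set} (L : List A) (n : ℕ) {P Q : Vec A n → Bool} → (∀ a → P a ≡ Q a) →
  #words L n P ≡ #words L n Q
#words-cong L zero    P≗Q = cong (if_then 1 else 0) (P≗Q [])
#words-cong L (suc n) P≗Q = ∑-cong L (λ x → #words-cong L n (P≗Q ∘ (x ∷_)))

module _ {A : Set} {p} {P : Pred A p} (P? : Decidable P) where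

  length-filter-map : {B : Set} (f : B → A) (xs : List B) →
    length (filter P? (map f xs)) ≡ length (filter (P? ∘ f) xs)
  length-filter-map f []       = refl
  length-filter-map f (x ∷ xs) with does (P? (f x))
  ... | true  = cong suc (length-filter-map f xs)
  ... | false = length-filter-map f xs

  length-filter-filter : ∀ {q} {Q : Pred A q} (Q? : Decidable Q) (xs : List A) →
    length (filter P? (filter Q? xs)) ≡ length (filter (Q? ∩? P?) xs)
  length-filter-filter Q? []       = refl
  length-filter-filter Q? (x ∷ xs) with does (Q? x)
  ... | false = length-filter-filter Q? xs
  ... | true with does (P? x)
  ...   | false = length-filter-filter Q? xs
  ...   | true  = cong suc (length-filter-filter Q? xs)

length-filter-words : (L : List T∞) (n : ℕ) → ∀ {p} {P : Pred (Vec T∞ n) p} (P? : Decidable P) →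
  length (filter P? (words n L)) ≡ #words L n (does ∘ P?)
length-filter-words L zero    P? with does (P? [])
... | true  = refl
... | false = refl
length-filter-words L (suc n) P? = go L
  where
  open ≡-Reasoning
  go : ∀ xs → length (filter P? (concatMap (λ x → map (x ∷_) (words n L)) xs)) ≡
              ∑ xs (λ x → #words L n (does ∘ P? ∘ (x ∷_)))
  go []       = refl
  go (x ∷ xs) = begin
    length (filter P? (map (x ∷_) (words n L) ++ rest))
      ≡⟨ cong length (filter-++ P? (map (x ∷_) (words n L)) rest) ⟩
    length (filter P? (map (x ∷_) (words n L)) ++ filter P? rest)
      ≡⟨ length-++ (filter P? (map (x ∷_) (words n L))) ⟩
    length (filter P? (map (x ∷_) (words n L))) + length (filter P? rest)
      ≡⟨ cong₂ _+_ (trans (length-filter-map P? (x ∷_) (words n L))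
                          (length-filter-words L n (P? ∘ (x ∷_))))
                   (go xs) ⟩
    #words L n (does ∘ P? ∘ (x ∷_)) + ∑ xs (λ y → #words L n (does ∘ P? ∘ (y ∷_)))
      ∎
    where rest = concatMap (λ y → map (y ∷_) (words n L)) xs

toggle : T∞ → T∞
toggle t0      = t0
toggle (inv k) = pos k
toggle (pos k) = inv k

toggle-involutive : ∀ x → toggle (toggle x) ≡ x
toggle-involutive t0      = refl
toggle-involutive (inv k) = refl
toggle-involutive (pos k) = refl

toggle-injective : Injective _≡_ _≡_ toggle
toggle-injective {x} {y} τx≡τy =
  trans (sym (toggle-involutive x)) (trans (cong toggle τx≡τy) (toggle-involutive y))

∣toggle∣ : ∀ x → ∣ toggle x ∣T ≡ ∣ x ∣T
∣toggle∣ t0      = refl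
∣toggle∣ (inv k) = refl
∣toggle∣ (pos k) = refl

∑-lettersUpTo-toggle : ∀ M (h : T∞ → ℕ) → ∑ (lettersUpTo M) (h ∘ toggle) ≡ ∑ (lettersUpTo M) h
∑-lettersUpTo-toggle M h = cong (h t0 +_) (pairs (upTo M))
  where
  pairs : ∀ ks → ∑ (concatMap (λ k → inv k ∷ pos k ∷ []) ks) (h ∘ toggle) ≡
                 ∑ (concatMap (λ k → inv k ∷ pos k ∷ []) ks) h
  pairs []       = refl
  pairs (k ∷ ks) = trans (x∙yz≈y∙xz (h (pos k)) (h (inv k)) _)
                         (cong (λ r → h (inv k) + (h (pos k) + r)) (pairs ks))

rank-injective : ∀ x y → rank x ≡ rank y → x ≡ y
rank-injective t0      t0      _ = refl
rank-injective (inv j) (inv k) e = cong inv (ℕP.*-cancelˡ-≡ j k 2 (ℕP.suc-injective e))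
rank-injective (pos j) (pos k) e =
  cong pos (ℕP.*-cancelˡ-≡ j k 2 (ℕP.suc-injective (ℕP.suc-injective e)))
rank-injective (inv j) (pos k) e = contradiction (trans (ℕP.*-suc 2 k) (sym e)) (ℕP.even≢odd (suc k) j)
rank-injective (pos j) (inv k) e = contradiction (trans (ℕP.*-suc 2 j) e) (ℕP.even≢odd (suc j) k)

-- Opaque, so that `does (x ≟T y)` stays a neutral term that `with` can abstract over.
opaque
  _≟T_ : DecidableEquality T∞
  x ≟T y = map′ (rank-injective x y) (cong rank) (rank x ℕ.≟ rank y)

-- ≤⁺ and ≤⁻ are the instances s = + and s = - of this relation, definitionally.
_≤[_]_ : T∞ → Sign → T∞ → Set
a ≤[ s ] b = (a <T b) ⊎ ((rank a ≡ rank b) × (ε a ≡ s))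

_≤[_]?_ : ∀ a s b → Dec (a ≤[ s ] b)
a ≤[ s ]? b = (rank a <? rank b) ⊎-dec ((rank a ℕ.≟ rank b) ×-dec (ε a ≟S s))

_≤[_]ᵇ_ : T∞ → Sign → T∞ → Bool
a ≤[ s ]ᵇ b = does (a ≤[ s ]? b)

≤[]-refl⇔ : ∀ x s → x ≤[ s ] x ⇔ ε x ≡ s
≤[]-refl⇔ x s = mk⇔
  (λ { (inj₁ x<x) → contradiction x<x (ℕP.<-irrefl refl) ; (inj₂ (_ , εx≡s)) → εx≡s })
  (λ εx≡s → inj₂ (refl , εx≡s))

≤[]⇔<T : ∀ {x y} s → x ≢ y → x ≤[ s ] y ⇔ x <T y
≤[]⇔<T {x} {y} s x≢y =
  mk⇔ (λ { (inj₁ x<y) → x<y ; (inj₂ (rx≡ry , _)) → contradiction (rank-injective x y rx≡ry) x≢y })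
      inj₁

≤[-]-inv⇔pos : ∀ b k → b ≤[ Sign.- ] inv k ⇔ b ≤[ Sign.- ] pos k
≤[-]-inv⇔pos b k = mk⇔ to′ from′
  where
  to′ : b ≤[ Sign.- ] inv k → b ≤[ Sign.- ] pos k
  to′ (inj₁ b<inv)      = inj₁ (ℕP.m<n⇒m<1+n b<inv)
  to′ (inj₂ (rb≡r , _)) = inj₁ (s≤s (ℕP.≤-reflexive rb≡r))
  from′ : b ≤[ Sign.- ] pos k → b ≤[ Sign.- ] inv k
  from′ (inj₁ (s≤s rb≤r)) with ℕP.m≤n⇒m<n∨m≡n rb≤r
  ... | inj₁ b<inv = inj₁ b<inv
  ... | inj₂ rb≡r  = inj₂ (rb≡r , cong ε (rank-injective b (inv k) rb≡r))
  from′ (inj₂ (rb≡r , εb≡-)) with rank-injective b (pos k) rb≡r | εb≡-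
  ... | refl | ()

inv≤[+]⇔pos : ∀ k z → inv k ≤[ Sign.+ ] z ⇔ pos k ≤[ Sign.+ ] z
inv≤[+]⇔pos k z = mk⇔ to′ from′
  where
  to′ : inv k ≤[ Sign.+ ] z → pos k ≤[ Sign.+ ] z
  to′ (inj₁ inv<z) with ℕP.m≤n⇒m<n∨m≡n inv<z
  ... | inj₁ pos<z = inj₁ pos<z
  ... | inj₂ r≡rz  = inj₂ (r≡rz , refl)
  to′ (inj₂ (_ , ()))
  from′ : pos k ≤[ Sign.+ ] z → inv k ≤[ Sign.+ ] z
  from′ (inj₁ pos<z)     = inj₁ (ℕP.<-trans (ℕP.n<1+n _) pos<z)
  from′ (inj₂ (r≡rz , _)) = inj₁ (ℕP.≤-reflexive r≡rz)

≰[-]t0 : ∀ b → ¬ b ≤[ Sign.- ] t0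
≰[-]t0 _       (inj₁ ())
≰[-]t0 t0      (inj₂ (_ , ()))
≰[-]t0 (inv _) (inj₂ (() , _))
≰[-]t0 (pos _) (inj₂ (() , _))

≤[]ᵇ-refl : ∀ x s → x ≤[ s ]ᵇ x ≡ does (ε x ≟S s)
≤[]ᵇ-refl x s = does-⇔ (≤[]-refl⇔ x s) (x ≤[ s ]? x) (ε x ≟S s)

≤[-]ᵇ≡≤[+]ᵇ : ∀ {x y} → x ≢ y → x ≤[ Sign.- ]ᵇ y ≡ x ≤[ Sign.+ ]ᵇ y
≤[-]ᵇ≡≤[+]ᵇ {x} {y} x≢y = trans (does-⇔ (≤[]⇔<T Sign.- x≢y) (x ≤[ Sign.- ]? y) (rank x <? rank y))
                                (sym (does-⇔ (≤[]⇔<T Sign.+ x≢y) (x ≤[ Sign.+ ]? y) (rank x <? rank y)))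

toggleTwinsAt : ∀ {n} → ℕ → Vec T∞ n → Vec T∞ n
toggleTwinsAt zero    (x ∷ y ∷ a) = if does (x ≟T y) then toggle x ∷ toggle y ∷ a else x ∷ y ∷ a
toggleTwinsAt (suc j) (x ∷ a)     = x ∷ toggleTwinsAt j a
toggleTwinsAt _       a           = a

#words-toggleTwinsAt : ∀ {L} → (∀ h → ∑ L (h ∘ toggle) ≡ ∑ L h) →
  ∀ n j (P : Vec T∞ n → Bool) → #words L n (P ∘ toggleTwinsAt j) ≡ #words L n P
#words-toggleTwinsAt     ∑-toggle zero          zero    P = refl
#words-toggleTwinsAt     ∑-toggle zero          (suc j) P = refl
#words-toggleTwinsAt {L} ∑-toggle (suc n)       (suc j) P =
  ∑-cong L (λ x → #words-toggleTwinsAt ∑-toggle n j (P ∘ (x ∷_)))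
#words-toggleTwinsAt     ∑-toggle (suc zero)    zero    P = refl
#words-toggleTwinsAt {L} ∑-toggle (suc (suc n)) zero    P =
  trans (∑∑-cong L float) (∑∑-reindex-diagonal _≟T_ toggle-injective L ∑-toggle W)
  where
  W : T∞ → T∞ → ℕ
  W x y = #words L n (λ a → P (x ∷ y ∷ a))
  float : ∀ x y → #words L n (λ a → P (toggleTwinsAt 0 (x ∷ y ∷ a))) ≡
                  (if does (x ≟T y) then W (toggle x) (toggle y) else W x y)
  float x y with does (x ≟T y)
  ... | true  = refl
  ... | false = refl

mult-∷-cong : ∀ {n} x y {a b : Vec T∞ n} k → ∣ x ∣T ≡ ∣ y ∣T → mult a k ≡ mult b k →
  mult (x ∷ a) k ≡ mult (y ∷ b) k
mult-∷-cong x y k ∣x∣≡∣y∣ eq with ∣ x ∣T ℕ.≟ k | ∣ y ∣T ℕ.≟ k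
... | yes _  | yes _  = cong suc eq
... | no _   | no _   = eq
... | yes p  | no ¬q  = contradiction (trans (sym ∣x∣≡∣y∣) p) ¬q
... | no ¬p  | yes q  = contradiction (trans ∣x∣≡∣y∣ q) ¬p

mult-toggleTwinsAt : ∀ {n} j (a : Vec T∞ n) k → mult (toggleTwinsAt j a) k ≡ mult a k
mult-toggleTwinsAt zero    (x ∷ y ∷ a) k with x ≟T y
... | yes _ = mult-∷-cong (toggle x) x k (∣toggle∣ x) (mult-∷-cong (toggle y) y k (∣toggle∣ y) refl)
... | no _  = refl
mult-toggleTwinsAt (suc j) (x ∷ a)     k = mult-∷-cong x x k refl (mult-toggleTwinsAt j a k)
mult-toggleTwinsAt zero    []          k = refl
mult-toggleTwinsAt zero    (x ∷ [])    k = refl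
mult-toggleTwinsAt (suc j) []          k = refl

hasMonomial-toggleTwinsAt : ∀ {n} M e j (a : Vec T∞ n) →
  does (HasMonomial? M e (toggleTwinsAt j a)) ≡ does (HasMonomial? M e a)
hasMonomial-toggleTwinsAt M e j a = does-⇔
  (mk⇔ (λ h k → trans (sym (mult-toggleTwinsAt j a (toℕ k))) (h k))
       (λ h k → trans (mult-toggleTwinsAt j a (toℕ k)) (h k)))
  (HasMonomial? M e (toggleTwinsAt j a)) (HasMonomial? M e a)

-- A sign sequence encodes a descent set (- at a descent, + elsewhere); b plays the role of a₀.
admissible : ∀ {n} → T∞ → Vec Sign n → Vec T∞ n → Bool
admissible b []       []      = true
admissible b (s ∷ ss) (x ∷ a) = b ≤[ s ]ᵇ x ∧ admissible x ss a

-- Distinct letters compare alike under ≤⁺ and ≤⁻. For twins, j⁻¹j⁻¹ under (-,-) matches jj under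
-- (-,+), while jj under (-,-), j⁻¹j⁻¹ under (-,+) and 00 after a descent are all forbidden.
admissible-twins : ∀ {n} b (ss : Vec Sign n) x y a →
  (∀ k → admissible (inv k) ss a ≡ admissible (pos k) ss a) →
  admissible b (Sign.- ∷ Sign.- ∷ ss) (x ∷ y ∷ a) ≡
  admissible b (Sign.- ∷ Sign.+ ∷ ss) (toggleTwinsAt 0 (x ∷ y ∷ a))
admissible-twins b ss x y a inv≡pos with x ≟T y
... | no x≢y = cong (λ c → b ≤[ Sign.- ]ᵇ x ∧ (c ∧ admissible y ss a)) (≤[-]ᵇ≡≤[+]ᵇ x≢y)
admissible-twins b ss t0 .t0 a inv≡pos | yes refl
  rewrite dec-false (b ≤[ Sign.- ]? t0) (≰[-]t0 b) = refl
admissible-twins b ss (inv k) .(inv k) a inv≡pos | yes refl =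
  cong₂ _∧_ (does-⇔ (≤[-]-inv⇔pos b k) (b ≤[ Sign.- ]? inv k) (b ≤[ Sign.- ]? pos k))
            (cong₂ _∧_ (trans (≤[]ᵇ-refl (inv k) Sign.-) (sym (≤[]ᵇ-refl (pos k) Sign.+))) (inv≡pos k))
admissible-twins b ss (pos k) .(pos k) a inv≡pos | yes refl = begin
  b ≤[ Sign.- ]ᵇ pos k ∧ (pos k ≤[ Sign.- ]ᵇ pos k ∧ admissible (pos k) ss a)
    ≡⟨ cong (λ c → b ≤[ Sign.- ]ᵇ pos k ∧ (c ∧ admissible (pos k) ss a)) (≤[]ᵇ-refl (pos k) Sign.-) ⟩
  b ≤[ Sign.- ]ᵇ pos k ∧ false
    ≡⟨ trans (∧-zeroʳ _) (sym (∧-zeroʳ _)) ⟩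
  b ≤[ Sign.- ]ᵇ inv k ∧ false
    ≡⟨ cong (λ c → b ≤[ Sign.- ]ᵇ inv k ∧ (c ∧ admissible (inv k) ss a)) (≤[]ᵇ-refl (inv k) Sign.+) ⟨
  b ≤[ Sign.- ]ᵇ inv k ∧ (inv k ≤[ Sign.+ ]ᵇ inv k ∧ admissible (inv k) ss a)
    ∎
  where open ≡-Reasoning

data DescentExtension : ∀ {n} → Vec Sign n → Vec Sign n → Set where
  at-end        : DescentExtension (Sign.- ∷ Sign.+ ∷ []) (Sign.- ∷ Sign.- ∷ [])
  before-ascent : ∀ {n} (ss : Vec Sign n) →
                  DescentExtension (Sign.- ∷ Sign.+ ∷ Sign.+ ∷ ss) (Sign.- ∷ Sign.- ∷ Sign.+ ∷ ss)
  later         : ∀ {n} {ss ss' : Vec Sign n} s → DescentExtension ss ss' →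
                  DescentExtension (s ∷ ss) (s ∷ ss')

position : ∀ {n} {ss ss' : Vec Sign n} → DescentExtension ss ss' → ℕ
position at-end            = 0
position (before-ascent _) = 0
position (later _ ext)     = suc (position ext)

admissible-descentExtension : ∀ {n} {ss ss' : Vec Sign n} (ext : DescentExtension ss ss') b a →
  admissible b ss' a ≡ admissible b ss (toggleTwinsAt (position ext) a)
admissible-descentExtension at-end             b (x ∷ y ∷ [])    = admissible-twins b [] x y [] (λ _ → refl)
admissible-descentExtension (before-ascent ss) b (x ∷ y ∷ z ∷ a) =
  admissible-twins b (Sign.+ ∷ ss) x y (z ∷ a)
    (λ k → cong (_∧ admissible z ss a)
                (does-⇔ (inv≤[+]⇔pos k z) (inv k ≤[ Sign.+ ]? z) (pos k ≤[ Sign.+ ]? z)))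
admissible-descentExtension (later s ext)      b (x ∷ a)         =
  cong (b ≤[ s ]ᵇ x ∧_) (admissible-descentExtension ext x a)

#admissible : ∀ {n} M → Vec ℕ (suc M) → Vec Sign n → ℕ
#admissible {n} M e ss = #words (lettersUpTo M) n (λ a → does (HasMonomial? M e a) ∧ admissible t0 ss a)

#admissible-descentExtension : ∀ {n} M e {ss ss' : Vec Sign n} → DescentExtension ss ss' →
  #admissible M e ss ≡ #admissible M e ss'
#admissible-descentExtension {n} M e {ss} {ss'} ext = begin
  #words L n (λ a → does (HasMonomial? M e a) ∧ admissible t0 ss a)
    ≡⟨ #words-toggleTwinsAt (∑-lettersUpTo-toggle M) n j _ ⟨
  #words L n (λ a → does (HasMonomial? M e (toggleTwinsAt j a)) ∧ admissible t0 ss (toggleTwinsAt j a))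
    ≡⟨ #words-cong L n (λ a → cong₂ _∧_ (hasMonomial-toggleTwinsAt M e j a)
                                        (sym (admissible-descentExtension ext t0 a))) ⟩
  #words L n (λ a → does (HasMonomial? M e a) ∧ admissible t0 ss' a)
    ∎
  where
  open ≡-Reasoning
  L = lettersUpTo M
  j = position ext

#admissible-connected : ∀ {n} M e {ss ss' : Vec Sign n} → EqClosure DescentExtension ss ss' →
  #admissible M e ss ≡ #admissible M e ss'
#admissible-connected M e = EqClosure.gfold isEquivalence (#admissible M e) (#admissible-descentExtension M e)

isPeak : Sign → Sign → Bool
isPeak Sign.+ Sign.- = true
isPeak _      _      = false

-- A peak of π at position i + 1, not i.
peak : ∀ {n} → Vec Sign n → ℕ → Bool
peak (_ ∷ ss)     (suc i) = peak ss i
peak (s ∷ s' ∷ _) zero    = isPeak s s'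
peak _            _       = false

later⋆ : ∀ {n} s {ss ss' : Vec Sign n} → EqClosure DescentExtension ss ss' →
  EqClosure DescentExtension (s ∷ ss) (s ∷ ss')
later⋆ s = EqClosure.gmap (s ∷_) (later s)

mutual
  samePeaks⇒connected′ : ∀ {n} s (r r' : Vec Sign n) → (∀ i → peak (s ∷ r) i ≡ peak (s ∷ r') i) →
    EqClosure DescentExtension (s ∷ r) (s ∷ r')
  samePeaks⇒connected′ s      []            []             _    = EqClosure.reflexive DescentExtension
  samePeaks⇒connected′ s      (Sign.+ ∷ r)  (Sign.+ ∷ r')  same =
    later⋆ s (samePeaks⇒connected′ Sign.+ r r' (same ∘ suc))
  samePeaks⇒connected′ s      (Sign.- ∷ r)  (Sign.- ∷ r')  same =
    later⋆ s (samePeaks⇒connected′ Sign.- r r' (same ∘ suc))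
  samePeaks⇒connected′ Sign.+ (Sign.+ ∷ r)  (Sign.- ∷ r')  same = contradiction (same 0) λ ()
  samePeaks⇒connected′ Sign.+ (Sign.- ∷ r)  (Sign.+ ∷ r')  same = contradiction (same 0) λ ()
  samePeaks⇒connected′ Sign.- (Sign.+ ∷ r)  (Sign.- ∷ r')  same = extendDescent r r' same
  samePeaks⇒connected′ Sign.- (Sign.- ∷ r)  (Sign.+ ∷ r')  same =
    EqClosure.symmetric DescentExtension (extendDescent r' r (sym ∘ same))

  extendDescent : ∀ {n} (r r' : Vec Sign n) →
    (∀ i → peak (Sign.- ∷ Sign.+ ∷ r) i ≡ peak (Sign.- ∷ Sign.- ∷ r') i) →
    EqClosure DescentExtension (Sign.- ∷ Sign.+ ∷ r) (Sign.- ∷ Sign.- ∷ r')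
  extendDescent []           []       _    = EqClosure.return at-end
  extendDescent (Sign.- ∷ r) (_ ∷ r') same = contradiction (same 1) λ ()
  extendDescent (Sign.+ ∷ r) r'       same =
    EqClosure.return (before-ascent r)
      ◅◅ later⋆ Sign.- (samePeaks⇒connected′ Sign.- (Sign.+ ∷ r) r' same′)
    where
    same′ : ∀ i → peak (Sign.- ∷ Sign.+ ∷ r) i ≡ peak (Sign.- ∷ r') i
    same′ zero    = same 1
    same′ (suc i) = same (suc (suc i))

samePeaks⇒connected : ∀ {n} {ss ss' : Vec Sign (suc n)} → head ss ≡ head ss' →
  (∀ i → peak ss i ≡ peak ss' i) → EqClosure DescentExtension ss ss'
samePeaks⇒connected {ss = s ∷ r} {.s ∷ r'} refl = samePeaks⇒connected′ s r r'

descentSign : ∀ {a} {A : Set a} → Dec A → Sign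
descentSign a? = if does a? then Sign.- else Sign.+

stepSigns : ∀ {n} → SignedPerm n → Vec Sign n
stepSigns π = tabulate (λ s → descentSign (DesB? π (toℕ s)))

T-does : ∀ {a} {A : Set a} (a? : Dec A) → T (does a?) ⇔ A
T-does (yes a) = mk⇔ (const a) (const _)
T-does (no ¬a) = mk⇔ (λ ()) ¬a

descentSign-step : ∀ {D : Set} (D? : Dec D) {x y} →
  ((¬ D → x ≤⁺ y) × (D → x ≤⁻ y)) ⇔ x ≤[ descentSign D? ] y
descentSign-step (yes d) =
  mk⇔ (λ (_ , onDescent) → onDescent d) (λ x≤⁻y → (λ ¬d → contradiction d ¬d) , const x≤⁻y)
descentSign-step (no ¬d) =
  mk⇔ (λ (onAscent , _) → onAscent ¬d) (λ x≤⁺y → const x≤⁺y , (λ d → contradiction d ¬d))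

-- Admissible π a is definitionally AdmissibleFrom (DesB π ∘ toℕ) t0 a.
AdmissibleFrom : ∀ {n} → (Fin n → Set) → T∞ → Vec T∞ n → Set
AdmissibleFrom {n} D b a = (s : Fin n) →
  (¬ D s → lookup (b ∷ a) (inject₁ s) ≤⁺ lookup (b ∷ a) (suc s)) ×
  (D s → lookup (b ∷ a) (inject₁ s) ≤⁻ lookup (b ∷ a) (suc s))

admissible-reflects : ∀ {n} {D : Fin n → Set} (D? : ∀ s → Dec (D s)) b (a : Vec T∞ n) →
  AdmissibleFrom D b a ⇔ T (admissible b (tabulate (descentSign ∘ D?)) a)
admissible-reflects D? b []      = mk⇔ (const _) (λ _ ())
admissible-reflects D? b (x ∷ a) = mk⇔ to′ from′
  where
  first = T-does (b ≤[ descentSign (D? zero) ]? x)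
  rest  = admissible-reflects (D? ∘ suc) x a
  to′ : AdmissibleFrom _ b (x ∷ a) → T (admissible b (tabulate (descentSign ∘ D?)) (x ∷ a))
  to′ adm = from T-∧ ( from first (to (descentSign-step (D? zero) {b} {x}) (adm zero))
                     , to rest (adm ∘ suc))
  from′ : T (admissible b (tabulate (descentSign ∘ D?)) (x ∷ a)) → AdmissibleFrom _ b (x ∷ a)
  from′ t zero    = from (descentSign-step (D? zero) {b} {x}) (to first (proj₁ (to T-∧ t)))
  from′ t (suc s) = from rest (proj₂ (to T-∧ t)) s

coeffDB≡#admissible : ∀ {n} (π : SignedPerm n) M e → coeffDB π M e ≡ #admissible M e (stepSigns π)
coeffDB≡#admissible {n} π M e = begin
  length (filter (Admissible? π) (filter (HasMonomial? M e) W))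
    ≡⟨ length-filter-filter (Admissible? π) (HasMonomial? M e) W ⟩
  length (filter (HasMonomial? M e ∩? Admissible? π) W)
    ≡⟨ length-filter-words (lettersUpTo M) n (HasMonomial? M e ∩? Admissible? π) ⟩
  #words (lettersUpTo M) n (λ a → does (HasMonomial? M e a) ∧ does (Admissible? π a))
    ≡⟨ #words-cong (lettersUpTo M) n (λ a → cong (does (HasMonomial? M e a) ∧_)
         (does-⇔ (admissible-reflects (DesB? π ∘ toℕ) t0 a) (Admissible? π a) (T? _))) ⟩
  #admissible M e (stepSigns π)
    ∎
  where
  open ≡-Reasoning
  W = words n (lettersUpTo M)

val-suc : ∀ {n} (π : SignedPerm n) {i} (i<n : i < n) →
  val π (suc i) ≡ applySign (positive π (fromℕ< i<n)) (suc (toℕ (perm π ⟨$⟩ʳ fromℕ< i<n)))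
val-suc {n} π {i} i<n with i <? n
... | yes _  = refl
... | no i≮n = contradiction i<n i≮n

∣applySign-suc∣ : ∀ b k → ℤ.∣ applySign b (suc k) ∣ ≡ suc k
∣applySign-suc∣ true  k = refl
∣applySign-suc∣ false k = refl

∣val-suc∣ : ∀ {n} (π : SignedPerm n) {i} (i<n : i < n) →
  ℤ.∣ val π (suc i) ∣ ≡ suc (toℕ (perm π ⟨$⟩ʳ fromℕ< i<n))
∣val-suc∣ π i<n = trans (cong ℤ.∣_∣ (val-suc π i<n)) (∣applySign-suc∣ (positive π (fromℕ< i<n)) _)

∣val-suc∣-injective : ∀ {n} (π : SignedPerm n) {i j} (i<n : i < n) (j<n : j < n) →
  ℤ.∣ val π (suc i) ∣ ≡ ℤ.∣ val π (suc j) ∣ → i ≡ j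
∣val-suc∣-injective π {i} {j} i<n j<n eq =
  fromℕ<-injective i j i<n j<n (perm-injective (toℕ-injective (ℕP.suc-injective
    (trans (sym (∣val-suc∣ π i<n)) (trans eq (∣val-suc∣ π j<n))))))
  where
  σ = perm π
  perm-injective : ∀ {u v} → σ ⟨$⟩ʳ u ≡ σ ⟨$⟩ʳ v → u ≡ v
  perm-injective eq = trans (sym (inverseˡ σ)) (trans (cong (σ ⟨$⟩ˡ_) eq) (inverseˡ σ))

val≢val-suc : ∀ {n} (π : SignedPerm n) {i} → i < n → val π i ≢ val π (suc i)
val≢val-suc π {zero}  0<n    eq = contradiction (trans (cong ℤ.∣_∣ eq) (∣val-suc∣ π 0<n)) λ ()
val≢val-suc π {suc i} 1+i<n  eq =
  contradiction (sym (∣val-suc∣-injective π (ℕP.<-trans (ℕP.n<1+n i) 1+i<n) 1+i<n (cong ℤ.∣_∣ eq)))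
                ℕP.1+n≢n

¬descent⇒ascent : ∀ {n} (π : SignedPerm n) {i} → i < n → ¬ DesB π i → val π i ℤ.< val π (suc i)
¬descent⇒ascent π {i} i<n ¬des with ℤP.<-cmp (val π i) (val π (suc i))
... | tri< asc _ _  = asc
... | tri≈ _ eq _   = contradiction eq (val≢val-suc π i<n)
... | tri> _ _ desc = contradiction (i<n , desc) ¬des

ascent⇒¬descent : ∀ {n} (π : SignedPerm n) {i} → val π i ℤ.< val π (suc i) → ¬ DesB π i
ascent⇒¬descent π asc (_ , desc) = ℤP.<-asym asc desc

isPeak-descentSign : ∀ {a b} {A : Set a} {B : Set b} (a? : Dec A) (b? : Dec B) →
  T (isPeak (descentSign a?) (descentSign b?)) ⇔ (¬ A × B)
isPeak-descentSign (yes a) _       = mk⇔ (λ ()) (λ (¬a , _) → ¬a a)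
isPeak-descentSign (no ¬a) (yes b) = mk⇔ (const (¬a , b)) (const _)
isPeak-descentSign (no ¬a) (no ¬b) = mk⇔ (λ ()) (λ (_ , b) → ¬b b)

peak-tabulate : ∀ n (σ : ℕ → Sign) i →
  peak (tabulate {n = n} (σ ∘ toℕ)) i ≡ (suc i <ᵇ n) ∧ isPeak (σ i) (σ (suc i))
peak-tabulate zero          σ i       = refl
peak-tabulate (suc zero)    σ zero    = refl
peak-tabulate (suc zero)    σ (suc i) = refl
peak-tabulate (suc (suc n)) σ zero    = refl
peak-tabulate (suc (suc n)) σ (suc i) = peak-tabulate (suc n) (σ ∘ suc) i

peak-stepSigns : ∀ {n} (π : SignedPerm n) i → T (peak (stepSigns π) i) ⇔ PeB π (suc i)
peak-stepSigns {n} π i = mk⇔ to′ from′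
  where
  σ : ℕ → Sign
  σ j = descentSign (DesB? π j)
  peakAt = isPeak-descentSign (DesB? π i) (DesB? π (suc i))
  to′ : T (peak (stepSigns π) i) → PeB π (suc i)
  to′ t with to peakAt (proj₂ (to T-∧ (subst T (peak-tabulate n σ i) t)))
  ... | ¬des , 1+i<n , desc =
    s≤s z≤n , 1+i<n , ¬descent⇒ascent π (ℕP.<-trans (ℕP.n<1+n i) 1+i<n) ¬des , desc
  from′ : PeB π (suc i) → T (peak (stepSigns π) i)
  from′ (_ , 1+i<n , asc , desc) = subst T (sym (peak-tabulate n σ i))
    (from T-∧ (ℕP.<⇒<ᵇ 1+i<n , from peakAt (ascent⇒¬descent π asc , (1+i<n , desc))))

<0⇔sign≡- : ∀ i → i ℤ.< 0ℤ ⇔ sign i ≡ Sign.-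
<0⇔sign≡- (ℤ.+ n)   = mk⇔ (λ { (ℤ.+<+ ()) }) (λ ())
<0⇔sign≡- -[1+ n ] = mk⇔ (const refl) (const ℤ.-<+)

descent-0⇔ : ∀ {m} (π : SignedPerm (suc m)) → DesB π 0 ⇔ sign (val π 1) ≡ Sign.-
descent-0⇔ π = mk⇔ (to (<0⇔sign≡- _) ∘ proj₂) (λ neg → z<s , from (<0⇔sign≡- _) neg)

head-stepSigns-cong : ∀ {m} (π π' : SignedPerm (suc m)) → sign (val π 1) ≡ sign (val π' 1) →
  head (stepSigns π) ≡ head (stepSigns π')
head-stepSigns-cong π π' sameSign = cong (if_then Sign.- else Sign.+) (does-⇔
  (⇔.trans (descent-0⇔ π)
    (⇔.trans (mk⇔ (trans (sym sameSign)) (trans sameSign)) (⇔.sym (descent-0⇔ π'))))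
  (DesB? π 0) (DesB? π' 0))

peak-stepSigns-cong : ∀ {n} (π π' : SignedPerm n) → (∀ i → PeB π i ⇔ PeB π' i) →
  ∀ i → peak (stepSigns π) i ≡ peak (stepSigns π') i
peak-stepSigns-cong π π' samePe i = does-⇔
  (⇔.trans (peak-stepSigns π i) (⇔.trans (samePe (suc i)) (⇔.sym (peak-stepSigns π' i))))
  (T? _) (T? _)

corollary6p4 : (m : ℕ) (π π' : SignedPerm (suc m))
    → (∀ i → PeB π i ⇔ PeB π' i)
    → sign (val π 1) ≡ sign (val π' 1)
    → π ≡DB π'
corollary6p4 m π π' samePe sameSign M e = begin
  coeffDB π M e                  ≡⟨ coeffDB≡#admissible π M e ⟩
  #admissible M e (stepSigns π)  ≡⟨ #admissible-connected M e connected ⟩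
  #admissible M e (stepSigns π') ≡⟨ coeffDB≡#admissible π' M e ⟨
  coeffDB π' M e                 ∎
  where
  open ≡-Reasoning
  connected : EqClosure DescentExtension (stepSigns π) (stepSigns π')
  connected = samePeaks⇒connected (head-stepSigns-cong π π' sameSign) (peak-stepSigns-cong π π' samePe)
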